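{- The double cosets $H'K$, $H'\tau_{1}K$ and $H'\tau_{2}K$ in $G$ are pairwise disjoint.
   Context: Let $F$ be a local field of characteristic zero, $\mathcal{O}_{F}$ its ring of integers and $\varpi$ a uniformizer. Let $G=\mathrm{GSp}_{6}(F)$ (w.r.t. $J=\left(\begin{smallmatrix} & 1_{3}\\ -1_{3} & \end{smallmatrix}\right)$), $K=\mathrm{GSp}_{6}(\mathcal{O}_{F})$, and $H'=\mathrm{GL}_{2}(F)\times_{F^{\times}}\mathrm{GSp}_{4}(F)$ embedded in $G$ via $\left(\left(\begin{smallmatrix} a&b\\ c&d\end{smallmatrix}\right),\left(\begin{smallmatrix} A&B\\ C&D\end{smallmatrix}\right)\right)\mapsto\left(\begin{smallmatrix} a&&b&\\ &A&&B\\ c&&d&\\ &C&&D\end{smallmatrix}\right)$. Let $$\tau_{1}=\left(\begin{smallmatrix}\varpi&&&&1&\\ &\varpi&&1&&\\ &&\varpi&&&\\ &&&1&&\\ &&&&1&\\ &&&&&1\end{smallmatrix}\right),\qquad \tau_{2}=\left(\begin{smallmatrix}\varpi&&&&\varpi^{ -1}&\\ &\varpi&&\varpi^{ -1}&&\\ &&1&&&\\ &&&\varpi^{ -1}&&\\ &&&&\varpi^{ -1}&\\ &&&&&1\end{smallmatrix}\right).$$ -}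

module Defs where

open import Level using (Level; _⊔_) renaming (suc to lsuc)
open import Algebra.Bundles using (CommutativeRing)
open import Data.Nat as ℕ using (ℕ; zero; suc)
open import Data.Integer as ℤ using (ℤ; +_; _⊓_)
open import Data.Fin using (Fin; zero; suc)
open import Data.Product using (Σ; ∃; _×_; _,_)
open import Relation.Nullary using (¬_)
open import Data.Empty using (⊥)
open import Relation.Binary.PropositionalEquality using () renaming (_≡_ to _≡ᵥ_)

data ℤ∞ : Set where
  fin : ℤ → ℤ∞
  ∞   : ℤ∞

infix 4 _≤∞_
data _≤∞_ : ℤ∞ → ℤ∞ → Set where
  fin≤fin : ∀ {m n} → m ℤ.≤ n → fin m ≤∞ fin n
  _≤∞∞    : ∀ x → x ≤∞ ∞

infixl 6 _+∞_
_+∞_ : ℤ∞ → ℤ∞ → ℤ∞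
fin m +∞ fin n = fin (m ℤ.+ n)
fin _ +∞ ∞     = ∞
∞     +∞ _     = ∞

min∞ : ℤ∞ → ℤ∞ → ℤ∞
min∞ (fin m) (fin n) = fin (m ⊓ n)
min∞ (fin m) ∞       = fin m
min∞ ∞       y       = y

ringFromℕ : ∀ {c ℓ} (R : CommutativeRing c ℓ) → ℕ → CommutativeRing.Carrier R
ringFromℕ R zero    = CommutativeRing.0# R
ringFromℕ R (suc n) = CommutativeRing._+_ R (CommutativeRing.1# R) (ringFromℕ R n)

record LocalField (c ℓ : Level) : Set (lsuc (c ⊔ ℓ)) where
  field
    cring : CommutativeRing c ℓ
  open CommutativeRing cring public

  field
    1≉0       : ¬ (1# ≈ 0#)
    _⁻¹       : Carrier → Carrier
    ⁻¹-inverse : ∀ x → ¬ (x ≈ 0#) → (x * (x ⁻¹)) ≈ 1#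
    v         : Carrier → ℤ∞
    v-cong    : ∀ {x y} → x ≈ y → v x ≡ᵥ v y
    v-zero    : ∀ x → v x ≡ᵥ ∞ → x ≈ 0#
    v-0       : v 0# ≡ᵥ ∞
    v-mul     : ∀ x y → v (x * y) ≡ᵥ (v x +∞ v y)
    v-add     : ∀ x y → min∞ (v x) (v y) ≤∞ v (x + y)
    ϖ         : Carrier
    v-ϖ       : v ϖ ≡ᵥ fin (+ 1)
    char0     : ∀ n → ¬ (ringFromℕ cring (suc n) ≈ 0#)
    complete  : (s : ℕ → Carrier) →
                (∀ N → ∃ λ M → ∀ m n → M ℕ.≤ m → M ℕ.≤ n →
                   fin N ≤∞ v (s m - s n)) →
                ∃ λ L → ∀ N → ∃ λ M → ∀ n → M ℕ.≤ n → fin N ≤∞ v (s n - L)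
    -- finite residue field: finitely many representatives of O_F / ϖ O_F
    residueFinite : ∃ λ (q : ℕ) → Σ (Fin q → Carrier) λ r →
                      (∀ i → fin (+ 0) ≤∞ v (r i)) ×
                      (∀ x → fin (+ 0) ≤∞ v x → ∃ λ i → fin (+ 1) ≤∞ v (x - r i))

  Integral : Carrier → Set
  Integral x = fin (+ 0) ≤∞ v x

  IntUnit : Carrier → Set
  IntUnit x = v x ≡ᵥ fin (+ 0)

open import Data.Sum using (_⊎_; inj₁; inj₂)
open import Data.Fin using (splitAt)
import Data.Fin as Fin
open import Relation.Nullary using (yes; no)

pattern f0 = zero
pattern f1 = suc f0
pattern f2 = suc f1
pattern f3 = suc f2
pattern f4 = suc f3
pattern f5 = suc f4

module Matrices {c ℓ} (F : LocalField c ℓ) where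
  open LocalField F hiding (zero)

  Mat : ℕ → Set c
  Mat n = Fin n → Fin n → Carrier

  infix 4 _≈ₘ_
  _≈ₘ_ : ∀ {n} → Mat n → Mat n → Set ℓ
  A ≈ₘ B = ∀ i j → A i j ≈ B i j

  Σᶠ : ∀ {n} → (Fin n → Carrier) → Carrier
  Σᶠ {ℕ.zero}  f = 0#
  Σᶠ {ℕ.suc n} f = f Fin.zero + Σᶠ (λ i → f (Fin.suc i))

  infixl 7 _·_
  _·_ : ∀ {n} → Mat n → Mat n → Mat n
  (A · B) i j = Σᶠ (λ k → A i k * B k j)

  _ᵀ : ∀ {n} → Mat n → Mat n
  (A ᵀ) i j = A j i

  _•_ : ∀ {n} → Carrier → Mat n → Mat n
  (a • A) i j = a * A i j

  δ : ∀ {n} → Fin n → Fin n → Carrier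
  δ i j with i Fin.≟ j
  ... | yes _ = 1#
  ... | no  _ = 0#

  1ₘ : ∀ {n} → Mat n
  1ₘ = δ

  -- J = ( 0 1ₙ ; -1ₙ 0 ) of size 2n
  J : ∀ n → Mat (n ℕ.+ n)
  J n i j with splitAt n i | splitAt n j
  ... | inj₁ a | inj₂ b = δ a b
  ... | inj₂ a | inj₁ b = - δ a b
  ... | _      | _      = 0#

  IsSim : ∀ n → Mat (n ℕ.+ n) → Carrier → Set ℓ
  IsSim n g μ = (g ᵀ) · J n · g ≈ₘ μ • J n

  InGSp : ∀ n → Mat (n ℕ.+ n) → Set (c ⊔ ℓ)
  InGSp n g = ∃ λ μ → ¬ (μ ≈ 0#) × IsSim n g μ

  InK : Mat 6 → Set (c ⊔ ℓ)
  InK k = (∀ i j → Integral (k i j)) × ∃ λ μ → IntUnit μ × IsSim 3 k μ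

  det₂ : Mat 2 → Carrier
  det₂ A = A f0 f0 * A f1 f1 - A f0 f1 * A f1 f0

  -- positions of GL_2 and GSp_4 coordinates inside the 6 coordinates
  ι : Fin 6 → Fin 2 ⊎ Fin 4
  ι f0 = inj₁ f0
  ι f1 = inj₂ f0
  ι f2 = inj₂ f1
  ι f3 = inj₁ f1
  ι f4 = inj₂ f2
  ι f5 = inj₂ f3

  embed : Mat 2 → Mat 4 → Mat 6
  embed A M i j with ι i | ι j
  ... | inj₁ a | inj₁ b = A a b
  ... | inj₂ a | inj₂ b = M a b
  ... | _      | _      = 0#

  -- h ∈ H' = GL_2(F) ×_{F×} GSp_4(F) (image in G): det A = sim(M) ∈ F×
  InH' : Mat 6 → Set (c ⊔ ℓ)
  InH' h = ∃ λ A → ∃ λ M → ∃ λ μ →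
             ¬ (μ ≈ 0#) × det₂ A ≈ μ × IsSim 2 M μ × h ≈ₘ embed A M

  InDoubleCoset : Mat 6 → Mat 6 → Set (c ⊔ ℓ)
  InDoubleCoset x g = ∃ λ h → ∃ λ k → InH' h × InK k × g ≈ₘ h · x · k

  Disjoint : (Mat 6 → Set (c ⊔ ℓ)) → (Mat 6 → Set (c ⊔ ℓ)) → Set (c ⊔ ℓ)
  Disjoint P Q = ∀ g → P g → Q g → ⊥

  τ₁ : Mat 6
  τ₁ f0 f0 = ϖ
  τ₁ f1 f1 = ϖ
  τ₁ f2 f2 = ϖ
  τ₁ f3 f3 = 1#
  τ₁ f4 f4 = 1#
  τ₁ f5 f5 = 1#
  τ₁ f0 f4 = 1#
  τ₁ f1 f3 = 1#
  τ₁ _  _  = 0#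

  τ₂ : Mat 6
  τ₂ f0 f0 = ϖ
  τ₂ f1 f1 = ϖ
  τ₂ f2 f2 = 1#
  τ₂ f3 f3 = ϖ ⁻¹
  τ₂ f4 f4 = ϖ ⁻¹
  τ₂ f5 f5 = 1#
  τ₂ f0 f4 = ϖ ⁻¹
  τ₂ f1 f3 = ϖ ⁻¹
  τ₂ _  _  = 0#

-- Suppose g = h₀ x k₀ = h₁ y k₁ with hᵢ = embed Aᵢ Mᵢ ∈ H′, kᵢ ∈ K and x integral. The relation
-- kᵀ J k = ν J with ν a unit gives k the integral left inverse ν⁻¹ Jᵀ kᵀ J, which over a field is
-- also a right inverse, so embed A₁ M₁ · y = embed A₀ M₀ · W with W = x k₀ k₁⁻¹ integral. The rows
-- 0, 3 of embed A M · X are A times the rows 0, 3 of X; hence the minor m on rows 0, 3 and columns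
-- 4, 3 satisfies det A₁ · m(y) = det A₀ · m(W). Comparing this with the similitude factor of g,
-- det Aᵢ · sim(x or y) · νᵢ, yields v(sim y) ≤ v(sim x) + v(m(y)). This fails for the three pairs
-- (1, τ₁), (1, τ₂), (τ₁, τ₂), as v(sim) is 0, 1, 0 on 1, τ₁, τ₂ while m(τ₁) = 1 and m(τ₂) = ϖ⁻².

module Submission where

open import Defs
open import Data.Product using (_×_)

open import Level using (_⊔_)
open import Algebra.Bundles using (CommutativeRing; AbelianGroup)
import Algebra.Properties.CommutativeSemigroup
import Algebra.Properties.Group
import Relation.Binary.Reasoning.Setoid
import Relation.Binary.Reasoning.Preorder
open import Data.Bool using (T)
open import Data.Empty using (⊥-elim)
open import Data.Fin as Fin using (Fin; zero; suc; punchIn; splitAt; combine; _↑ˡ_; _↑ʳ_)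
import Data.Fin.Properties as Fin
open import Data.Integer as ℤ using (ℤ; +_; -[1+_])
import Data.Integer.Properties as ℤ
open import Data.Maybe using (Maybe; just; nothing; is-just; to-witness-T)
open import Data.Nat as ℕ using (ℕ; zero; suc)
import Data.Nat.Properties as ℕ
open import Data.Product using (∃; _,_; proj₁; proj₂)
open import Data.Sign as Sign using (Sign)
open import Data.Sum using (_⊎_; inj₁; inj₂)
open import Data.Vec as Vec using (Vec; []; _∷_; _++_)
import Data.Vec.Properties as Vec
open import Data.Vec.Functional using (insertAt) renaming (_∷_ to _∷ᶠ_)
open import Data.Vec.Functional.Properties using (insertAt-lookup; insertAt-punchIn)
open import Function using (_∘_)
open import Relation.Binary using (Setoid; Preorder)
open import Relation.Nullary using (¬_; yes; no; Dec; ¬?)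
open import Relation.Binary.PropositionalEquality as ≡ using (_≡_; _≢_)

module ℤ-group = Algebra.Properties.Group (AbelianGroup.group ℤ.+-0-abelianGroup)

module IntegerCoefficients {c ℓ} (R : CommutativeRing c ℓ) where
  open CommutativeRing R
  open import Algebra.Properties.Ring ring using (-‿distribˡ-*; -‿distribʳ-*; -0#≈0#; -‿involutive; -‿anti-homo-+)
  open import Algebra.Properties.Semiring.Mult.TCOptimised semiring using (1+×; ×-homo-+; ×1-homo-*) renaming (_×_ to _×′_)
  open import Algebra.Solver.Ring.AlmostCommutativeRing
  open import Relation.Binary.Reasoning.Setoid setoid

  ⟦_⟧ℤ : ℤ → Carrier
  ⟦ + n ⟧ℤ = n ×′ 1#
  ⟦ -[1+ n ] ⟧ℤ = - (suc n ×′ 1#)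

  signed : Sign → Carrier → Carrier
  signed Sign.+ x = x
  signed Sign.- x = - x

  signed-cong : ∀ s {x y} → x ≈ y → signed s x ≈ signed s y
  signed-cong Sign.+ x≈y = x≈y
  signed-cong Sign.- x≈y = -‿cong x≈y

  signed-* : ∀ s t x y → signed (s Sign.* t) (x * y) ≈ signed s x * signed t y
  signed-* Sign.+ Sign.+ x y = refl
  signed-* Sign.+ Sign.- x y = -‿distribʳ-* x y
  signed-* Sign.- Sign.+ x y = -‿distribˡ-* x y
  signed-* Sign.- Sign.- x y = begin
    x * y           ≈⟨ -‿involutive _ ⟨
    - - (x * y)     ≈⟨ -‿cong (-‿distribˡ-* x y) ⟩
    - (- x * y)     ≈⟨ -‿distribʳ-* (- x) y ⟩
    - x * - y       ∎

  ⟦◃⟧ : ∀ s n → ⟦ s ℤ.◃ n ⟧ℤ ≈ signed s (n ×′ 1#)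
  ⟦◃⟧ Sign.+ zero    = refl
  ⟦◃⟧ Sign.- zero    = sym -0#≈0#
  ⟦◃⟧ Sign.+ (suc n) = refl
  ⟦◃⟧ Sign.- (suc n) = refl

  ⟦⟧ℤ-* : ∀ i j → ⟦ i ℤ.* j ⟧ℤ ≈ ⟦ i ⟧ℤ * ⟦ j ⟧ℤ
  ⟦⟧ℤ-* i j = begin
    ⟦ si Sign.* sj ℤ.◃ ℤ.∣ i ∣ ℕ.* ℤ.∣ j ∣ ⟧ℤ       ≈⟨ ⟦◃⟧ (si Sign.* sj) (ℤ.∣ i ∣ ℕ.* ℤ.∣ j ∣) ⟩
    signed (si Sign.* sj) ((ℤ.∣ i ∣ ℕ.* ℤ.∣ j ∣) ×′ 1#) ≈⟨ signed-cong (si Sign.* sj) (×1-homo-* ℤ.∣ i ∣ ℤ.∣ j ∣) ⟩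
    signed (si Sign.* sj) (∣i∣ * ∣j∣)                   ≈⟨ signed-* si sj _ _ ⟩
    signed si ∣i∣ * signed sj ∣j∣                       ≈⟨ *-cong (signAbs i) (signAbs j) ⟩
    ⟦ i ⟧ℤ * ⟦ j ⟧ℤ                                     ∎
    where
    si = ℤ.sign i
    sj = ℤ.sign j
    ∣i∣ = ℤ.∣ i ∣ ×′ 1#
    ∣j∣ = ℤ.∣ j ∣ ×′ 1#
    signAbs : ∀ k → signed (ℤ.sign k) (ℤ.∣ k ∣ ×′ 1#) ≈ ⟦ k ⟧ℤ
    signAbs (+ n)    = refl
    signAbs -[1+ n ] = refl

  [1+x]-[1+y]≈x-y : ∀ x y → (1# + x) - (1# + y) ≈ x - y
  [1+x]-[1+y]≈x-y x y = begin
    (1# + x) - (1# + y)        ≈⟨ +-congˡ (-‿anti-homo-+ 1# y) ⟩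
    (1# + x) + (- y - 1#)      ≈⟨ +-assoc 1# x _ ⟩
    1# + (x + (- y - 1#))      ≈⟨ +-congˡ (+-assoc x (- y) (- 1#)) ⟨
    1# + ((x - y) - 1#)        ≈⟨ +-congˡ (+-comm _ (- 1#)) ⟩
    1# + (- 1# + (x - y))      ≈⟨ +-assoc 1# (- 1#) _ ⟨
    (1# - 1#) + (x - y)        ≈⟨ +-congʳ (-‿inverseʳ 1#) ⟩
    0# + (x - y)               ≈⟨ +-identityˡ _ ⟩
    x - y                      ∎

  ⟦⟧ℤ-⊖ : ∀ m n → ⟦ m ℤ.⊖ n ⟧ℤ ≈ m ×′ 1# - n ×′ 1#
  ⟦⟧ℤ-⊖ zero    zero    = sym (-‿inverseʳ 0#)
  ⟦⟧ℤ-⊖ zero    (suc n) = sym (+-identityˡ _)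
  ⟦⟧ℤ-⊖ (suc m) zero    = sym (trans (+-congˡ -0#≈0#) (+-identityʳ _))
  ⟦⟧ℤ-⊖ (suc m) (suc n) = begin
    ⟦ suc m ℤ.⊖ suc n ⟧ℤ              ≡⟨ ≡.cong ⟦_⟧ℤ (ℤ.[1+m]⊖[1+n]≡m⊖n m n) ⟩
    ⟦ m ℤ.⊖ n ⟧ℤ                      ≈⟨ ⟦⟧ℤ-⊖ m n ⟩
    m ×′ 1# - n ×′ 1#                   ≈⟨ [1+x]-[1+y]≈x-y _ _ ⟨
    (1# + m ×′ 1#) - (1# + n ×′ 1#)     ≈⟨ +-cong (1+× m 1#) (-‿cong (1+× n 1#)) ⟨
    suc m ×′ 1# - suc n ×′ 1#           ∎

  ⟦⟧ℤ-+ : ∀ i j → ⟦ i ℤ.+ j ⟧ℤ ≈ ⟦ i ⟧ℤ + ⟦ j ⟧ℤ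
  ⟦⟧ℤ-+ (+ m)    (+ n)    = ×-homo-+ 1# m n
  ⟦⟧ℤ-+ (+ m)    -[1+ n ] = ⟦⟧ℤ-⊖ m (suc n)
  ⟦⟧ℤ-+ -[1+ m ] (+ n)    = trans (⟦⟧ℤ-⊖ n (suc m)) (+-comm _ _)
  ⟦⟧ℤ-+ -[1+ m ] -[1+ n ] = begin
    - (suc (suc (m ℕ.+ n)) ×′ 1#)           ≡⟨ ≡.cong (λ k → - (suc k ×′ 1#)) (ℕ.+-suc m n) ⟨
    - ((suc m ℕ.+ suc n) ×′ 1#)             ≈⟨ -‿cong (×-homo-+ 1# (suc m) (suc n)) ⟩
    - (suc m ×′ 1# + suc n ×′ 1#)            ≈⟨ -‿anti-homo-+ _ _ ⟩
    - (suc n ×′ 1#) - suc m ×′ 1#            ≈⟨ +-comm _ _ ⟩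
    - (suc m ×′ 1#) - suc n ×′ 1#            ∎

  ⟦⟧ℤ-neg : ∀ i → ⟦ ℤ.- i ⟧ℤ ≈ - ⟦ i ⟧ℤ
  ⟦⟧ℤ-neg (+ zero)  = sym -0#≈0#
  ⟦⟧ℤ-neg (+ suc n) = refl
  ⟦⟧ℤ-neg -[1+ n ]  = sym (-‿involutive _)

  ℤ⟶R : ℤ.+-*-rawRing -Raw-AlmostCommutative⟶ fromCommutativeRing R
  ℤ⟶R = record
    { ⟦_⟧ = ⟦_⟧ℤ ; +-homo = ⟦⟧ℤ-+ ; *-homo = ⟦⟧ℤ-* ; -‿homo = ⟦⟧ℤ-neg
    ; 0-homo = refl ; 1-homo = refl }

  _≟ℤ_ : ∀ i j → Maybe (⟦ i ⟧ℤ ≈ ⟦ j ⟧ℤ)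
  i ≟ℤ j with i ℤ.≟ j
  ... | yes ≡.refl = just refl
  ... | no _       = nothing

  open import Algebra.Solver.Ring ℤ.+-*-rawRing (fromCommutativeRing R) ℤ⟶R _≟ℤ_ public

all? : ∀ {a} n {P : Fin n → Set a} → (∀ i → Maybe (P i)) → Maybe (∀ i → P i)
all? zero    f = just λ ()
all? (suc n) f with f zero | all? n (f ∘ suc)
... | just p | just ps = just λ { zero → p ; (suc i) → ps i }
... | _      | _       = nothing

fin-injective : ∀ {m n} → fin m ≡ fin n → m ≡ n
fin-injective ≡.refl = ≡.refl

+∞-inverseʳ-unique : ∀ a x → fin a +∞ x ≡ fin (+ 0) → x ≡ fin (ℤ.- a)
+∞-inverseʳ-unique a (fin n) a+n≡0 = ≡.cong fin (ℤ-group.inverseʳ-unique a n (fin-injective a+n≡0))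

fin≤fin⁻¹ : ∀ {m n} → fin m ≤∞ fin n → m ℤ.≤ n
fin≤fin⁻¹ (fin≤fin m≤n) = m≤n

≤∞-refl : ∀ {x} → x ≤∞ x
≤∞-refl {fin m} = fin≤fin ℤ.≤-refl
≤∞-refl {∞}     = ∞ ≤∞∞

≤∞-trans : ∀ {x y z} → x ≤∞ y → y ≤∞ z → x ≤∞ z
≤∞-trans (fin≤fin p) (fin≤fin q) = fin≤fin (ℤ.≤-trans p q)
≤∞-trans _           (_ ≤∞∞)     = _ ≤∞∞

≤∞-preorder : Preorder _ _ _
≤∞-preorder = record
  { Carrier = ℤ∞ ; _≈_ = _≡_ ; _≲_ = _≤∞_
  ; isPreorder = record
    { isEquivalence = ≡.isEquivalence
    ; reflexive = λ { ≡.refl → ≤∞-refl }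
    ; trans = ≤∞-trans } }

module ≤∞-Reasoning = Relation.Binary.Reasoning.Preorder ≤∞-preorder

+∞-identityʳ : ∀ x → x +∞ fin (+ 0) ≡ x
+∞-identityʳ (fin m) = ≡.cong fin (ℤ.+-identityʳ m)
+∞-identityʳ ∞       = ≡.refl

+∞-comm : ∀ x y → x +∞ y ≡ y +∞ x
+∞-comm (fin m) (fin n) = ≡.cong fin (ℤ.+-comm m n)
+∞-comm (fin m) ∞       = ≡.refl
+∞-comm ∞       (fin n) = ≡.refl
+∞-comm ∞       ∞       = ≡.refl

+∞-assoc : ∀ x y z → x +∞ y +∞ z ≡ x +∞ (y +∞ z)
+∞-assoc (fin m) (fin n) (fin o) = ≡.cong fin (ℤ.+-assoc m n o)
+∞-assoc (fin m) (fin n) ∞       = ≡.refl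
+∞-assoc (fin m) ∞       z       = ≡.refl
+∞-assoc ∞       y       z       = ≡.refl

+∞-monoʳ-≤ : ∀ x {y z} → y ≤∞ z → x +∞ y ≤∞ x +∞ z
+∞-monoʳ-≤ (fin m) (fin≤fin p) = fin≤fin (ℤ.+-monoʳ-≤ m p)
+∞-monoʳ-≤ (fin m) (_ ≤∞∞)     = _ ≤∞∞
+∞-monoʳ-≤ ∞       _           = ∞ ≤∞∞

x≤∞x+∞y : ∀ x {y} → fin (+ 0) ≤∞ y → x ≤∞ x +∞ y
x≤∞x+∞y x {y} 0≤y = ≡.subst (_≤∞ x +∞ y) (+∞-identityʳ x) (+∞-monoʳ-≤ x 0≤y)

+∞-cancelˡ-≤ : ∀ a {x y} → fin a +∞ x ≤∞ fin a +∞ y → x ≤∞ y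
+∞-cancelˡ-≤ a {fin m} {fin n} (fin≤fin p) =
  fin≤fin (≡.subst₂ ℤ._≤_ (ℤ-group.\\-leftDividesʳ a m) (ℤ-group.\\-leftDividesʳ a n) (ℤ.+-monoʳ-≤ (ℤ.- a) p))
+∞-cancelˡ-≤ a {x}     {∞}     _           = _ ≤∞∞

+∞-nonneg : ∀ {x y} → fin (+ 0) ≤∞ x → fin (+ 0) ≤∞ y → fin (+ 0) ≤∞ x +∞ y
+∞-nonneg (fin≤fin p) (fin≤fin q) = fin≤fin (ℤ.+-mono-≤ p q)
+∞-nonneg (fin≤fin p) (_ ≤∞∞)     = _ ≤∞∞
+∞-nonneg (_ ≤∞∞)     _           = _ ≤∞∞

min∞-glb : ∀ {x y z} → z ≤∞ x → z ≤∞ y → z ≤∞ min∞ x y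
min∞-glb (fin≤fin p) (fin≤fin q) = fin≤fin (ℤ.⊓-glb p q)
min∞-glb (fin≤fin p) (_ ≤∞∞)     = fin≤fin p
min∞-glb (_ ≤∞∞)     q           = q

module OverLocalField {c ℓ} (F : LocalField c ℓ) where
  open LocalField F hiding (zero)
  open Matrices F
  open import Algebra.Properties.Ring ring using (-‿distribˡ-*; -‿distribʳ-*; -0#≈0#; -‿anti-homo-+; -1*x≈-x; -‿involutive)
  open import Data.Vec.Functional.Relation.Binary.Equality.Setoid using (≋-setoid)

  module ≈-Reasoning = Relation.Binary.Reasoning.Setoid setoid
  module +-CS = Algebra.Properties.CommutativeSemigroup +-commutativeSemigroup
  module *-CS = Algebra.Properties.CommutativeSemigroup *-commutativeSemigroup

  Σᶠ-cong : ∀ {n} {f g : Fin n → Carrier} → (∀ i → f i ≈ g i) → Σᶠ f ≈ Σᶠ g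
  Σᶠ-cong {zero}  f≈g = refl
  Σᶠ-cong {suc n} f≈g = +-cong (f≈g zero) (Σᶠ-cong (f≈g ∘ suc))

  Σᶠ-zero : ∀ {n} {f : Fin n → Carrier} → (∀ i → f i ≈ 0#) → Σᶠ f ≈ 0#
  Σᶠ-zero {zero}  f≈0 = refl
  Σᶠ-zero {suc n} f≈0 = trans (+-cong (f≈0 zero) (Σᶠ-zero (f≈0 ∘ suc))) (+-identityˡ 0#)

  Σᶠ-+ : ∀ {n} (f g : Fin n → Carrier) → Σᶠ (λ i → f i + g i) ≈ Σᶠ f + Σᶠ g
  Σᶠ-+ {zero}  f g = sym (+-identityˡ 0#)
  Σᶠ-+ {suc n} f g = trans (+-congˡ (Σᶠ-+ (f ∘ suc) (g ∘ suc))) (+-CS.interchange _ _ _ _)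

  Σᶠ-neg : ∀ {n} (f : Fin n → Carrier) → Σᶠ (λ i → - f i) ≈ - Σᶠ f
  Σᶠ-neg {zero}  f = sym -0#≈0#
  Σᶠ-neg {suc n} f = trans (+-congˡ (Σᶠ-neg (f ∘ suc))) (trans (+-comm _ _) (sym (-‿anti-homo-+ _ _)))

  *-distribˡ-Σᶠ : ∀ {n} a (f : Fin n → Carrier) → a * Σᶠ f ≈ Σᶠ (λ i → a * f i)
  *-distribˡ-Σᶠ {zero}  a f = zeroʳ a
  *-distribˡ-Σᶠ {suc n} a f = trans (distribˡ _ _ _) (+-congˡ (*-distribˡ-Σᶠ a (f ∘ suc)))

  *-distribʳ-Σᶠ : ∀ {n} a (f : Fin n → Carrier) → Σᶠ f * a ≈ Σᶠ (λ i → f i * a)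
  *-distribʳ-Σᶠ {zero}  a f = zeroˡ a
  *-distribʳ-Σᶠ {suc n} a f = trans (distribʳ _ _ _) (+-congˡ (*-distribʳ-Σᶠ a (f ∘ suc)))

  Σᶠ-swap : ∀ {m n} (f : Fin m → Fin n → Carrier) →
            Σᶠ (λ i → Σᶠ (λ j → f i j)) ≈ Σᶠ (λ j → Σᶠ (λ i → f i j))
  Σᶠ-swap {zero}  {n} f = sym (Σᶠ-zero {n} λ _ → refl)
  Σᶠ-swap {suc m} {n} f = trans (+-congˡ (Σᶠ-swap (f ∘ suc))) (sym (Σᶠ-+ {n} (f zero) _))

  Σᶠ-punchIn : ∀ {n} (j : Fin (suc n)) (f : Fin (suc n) → Carrier) → Σᶠ f ≈ f j + Σᶠ (f ∘ punchIn j)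
  Σᶠ-punchIn          zero    f = refl
  Σᶠ-punchIn {suc n} (suc j) f = trans (+-congˡ (Σᶠ-punchIn j (f ∘ suc))) (+-CS.x∙yz≈y∙xz _ _ _)

  δ-refl : ∀ {n} (i : Fin n) → δ i i ≈ 1#
  δ-refl i with i Fin.≟ i
  ... | yes _  = refl
  ... | no i≢i = ⊥-elim (i≢i ≡.refl)

  δ-≢ : ∀ {n} {i j : Fin n} → i ≢ j → δ i j ≈ 0#
  δ-≢ {i = i} {j} i≢j with i Fin.≟ j
  ... | yes i≡j = ⊥-elim (i≢j i≡j)
  ... | no _    = refl

  Σᶠ-δˡ : ∀ {n} (i : Fin n) (f : Fin n → Carrier) → Σᶠ (λ l → δ i l * f l) ≈ f i
  Σᶠ-δˡ {suc n} i f = begin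
    Σᶠ (λ l → δ i l * f l)                                      ≈⟨ Σᶠ-punchIn i (λ l → δ i l * f l) ⟩
    δ i i * f i + Σᶠ (λ l → δ i (punchIn i l) * f (punchIn i l)) ≈⟨ +-cong (*-congʳ (δ-refl i)) (Σᶠ-zero off-diagonal) ⟩
    1# * f i + 0#                                               ≈⟨ +-identityʳ _ ⟩
    1# * f i                                                    ≈⟨ *-identityˡ _ ⟩
    f i                                                         ∎
    where
    open ≈-Reasoning
    off-diagonal : ∀ l → δ i (punchIn i l) * f (punchIn i l) ≈ 0#
    off-diagonal l = trans (*-congʳ (δ-≢ (Fin.punchInᵢ≢i i l ∘ ≡.sym))) (zeroˡ _)

  Σᶠ-δʳ : ∀ {n} (i : Fin n) (f : Fin n → Carrier) → Σᶠ (λ l → f l * δ l i) ≈ f i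
  Σᶠ-δʳ i f = trans (Σᶠ-cong λ l → trans (*-comm _ _) (*-congʳ (δ-sym l))) (Σᶠ-δˡ i f)
    where
    δ-sym : ∀ l → δ l i ≈ δ i l
    δ-sym l with l Fin.≟ i | i Fin.≟ l
    ... | yes _   | yes _   = refl
    ... | no _    | no _    = refl
    ... | yes l≡i | no i≢l  = ⊥-elim (i≢l (≡.sym l≡i))
    ... | no l≢i  | yes i≡l = ⊥-elim (l≢i (≡.sym i≡l))

  Mat-setoid : ℕ → Setoid c ℓ
  Mat-setoid n = ≋-setoid (≋-setoid setoid n) n

  module ≈ₘ {n} = Setoid (Mat-setoid n)
  module ≈ₘ-Reasoning {n} = Relation.Binary.Reasoning.Setoid (Mat-setoid n)

  ·-cong : ∀ {n} {A A′ B B′ : Mat n} → A ≈ₘ A′ → B ≈ₘ B′ → A · B ≈ₘ A′ · B′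
  ·-cong {n} A≈A′ B≈B′ i j = Σᶠ-cong {n} λ l → *-cong (A≈A′ i l) (B≈B′ l j)

  ·-assoc : ∀ {n} (A B C : Mat n) → A · B · C ≈ₘ A · (B · C)
  ·-assoc {n} A B C i j = begin
    Σᶠ (λ l → Σᶠ (λ k → A i k * B k l) * C l j)     ≈⟨ Σᶠ-cong {n} (λ l → *-distribʳ-Σᶠ {n} (C l j) _) ⟩
    Σᶠ (λ l → Σᶠ (λ k → A i k * B k l * C l j))     ≈⟨ Σᶠ-swap {n} {n} _ ⟩
    Σᶠ (λ k → Σᶠ (λ l → A i k * B k l * C l j))     ≈⟨ Σᶠ-cong {n} (λ k → Σᶠ-cong {n} λ l → *-assoc _ _ _) ⟩
    Σᶠ (λ k → Σᶠ (λ l → A i k * (B k l * C l j)))   ≈⟨ Σᶠ-cong {n} (λ k → *-distribˡ-Σᶠ {n} (A i k) _) ⟨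
    Σᶠ (λ k → A i k * Σᶠ (λ l → B k l * C l j))     ∎
    where open ≈-Reasoning

  ·-identityˡ : ∀ {n} (A : Mat n) → 1ₘ · A ≈ₘ A
  ·-identityˡ A i j = Σᶠ-δˡ i (λ k → A k j)

  ·-identityʳ : ∀ {n} (A : Mat n) → A · 1ₘ ≈ₘ A
  ·-identityʳ A i j = Σᶠ-δʳ j (A i)

  ·-congˡ : ∀ {n} (A : Mat n) {B B′ : Mat n} → B ≈ₘ B′ → A · B ≈ₘ A · B′
  ·-congˡ A B≈B′ = ·-cong {A = A} (λ _ _ → refl) B≈B′

  ·-congʳ : ∀ {n} (B : Mat n) {A A′ : Mat n} → A ≈ₘ A′ → A · B ≈ₘ A′ · B
  ·-congʳ B A≈A′ = ·-cong {B = B} A≈A′ (λ _ _ → refl)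

  ᵀ-· : ∀ {n} (A B : Mat n) → (A · B) ᵀ ≈ₘ B ᵀ · A ᵀ
  ᵀ-· {n} A B i j = Σᶠ-cong {n} λ k → *-comm _ _

  •-cong : ∀ {n} {a b} {A B : Mat n} → a ≈ b → A ≈ₘ B → a • A ≈ₘ b • B
  •-cong a≈b A≈B i j = *-cong a≈b (A≈B i j)

  •-congˡ : ∀ {n} a {A B : Mat n} → A ≈ₘ B → a • A ≈ₘ a • B
  •-congˡ a A≈B i j = *-congˡ (A≈B i j)

  •-·ˡ : ∀ {n} a (A B : Mat n) → (a • A) · B ≈ₘ a • (A · B)
  •-·ˡ {n} a A B i j = trans (Σᶠ-cong {n} λ k → *-assoc _ _ _) (sym (*-distribˡ-Σᶠ {n} a _))

  •-·ʳ : ∀ {n} a (A B : Mat n) → A · (a • B) ≈ₘ a • (A · B)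
  •-·ʳ {n} a A B i j = trans (Σᶠ-cong {n} λ k → *-CS.x∙yz≈y∙xz (A i k) a (B k j)) (sym (*-distribˡ-Σᶠ {n} a _))

  •-• : ∀ {n} a b (A : Mat n) → a • (b • A) ≈ₘ (a * b) • A
  •-• a b A i j = sym (*-assoc a b (A i j))

  _≟0 : ∀ x → Dec (x ≈ 0#)
  x ≟0 with v x in vx≡
  ... | ∞     = yes (v-zero x vx≡)
  ... | fin n = no λ x≈0 → fin≢∞ (≡.trans (≡.sym vx≡) (≡.trans (v-cong x≈0) v-0))
    where
    fin≢∞ : ∀ {m} → fin m ≢ ∞
    fin≢∞ ()

  v-finite : ∀ {x} → ¬ x ≈ 0# → ∃ λ n → v x ≡ fin n
  v-finite {x} x≉0 with v x in vx≡
  ... | fin n = n , ≡.refl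
  ... | ∞     = ⊥-elim (x≉0 (v-zero x vx≡))

  IntUnit⇒≉0 : ∀ {x} → IntUnit x → ¬ x ≈ 0#
  IntUnit⇒≉0 {x} vx≡0 x≈0 with ≡.trans (≡.sym vx≡0) (≡.trans (v-cong x≈0) v-0)
  ... | ()

  ϖ≉0 : ¬ ϖ ≈ 0#
  ϖ≉0 ϖ≈0 with ≡.trans (≡.sym v-ϖ) (≡.trans (v-cong ϖ≈0) v-0)
  ... | ()

  v-*-fin : ∀ {x y m n} → v x ≡ fin m → v y ≡ fin n → v (x * y) ≡ fin (m ℤ.+ n)
  v-*-fin {x} {y} vx≡ vy≡ = ≡.trans (v-mul x y) (≡.cong₂ _+∞_ vx≡ vy≡)

  v-1 : v 1# ≡ fin (+ 0)
  v-1 with v-finite 1≉0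
  ... | n , v1≡ = ≡.trans v1≡ (≡.cong fin (ℤ-group.identityʳ-unique n n (fin-injective n+n≡n)))
    where
    n+n≡n : fin (n ℤ.+ n) ≡ fin n
    n+n≡n = ≡.trans (≡.sym (v-*-fin v1≡ v1≡)) (≡.trans (v-cong (*-identityˡ 1#)) v1≡)

  v-inverse : ∀ {x} → ¬ x ≈ 0# → v x +∞ v (x ⁻¹) ≡ fin (+ 0)
  v-inverse {x} x≉0 = ≡.trans (≡.sym (v-mul x (x ⁻¹))) (≡.trans (v-cong (⁻¹-inverse x x≉0)) v-1)

  v-ϖ⁻¹ : v (ϖ ⁻¹) ≡ fin -[1+ 0 ]
  v-ϖ⁻¹ = +∞-inverseʳ-unique (+ 1) _ (≡.trans (≡.cong (_+∞ v (ϖ ⁻¹)) (≡.sym v-ϖ)) (v-inverse ϖ≉0))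

  IntUnit-⁻¹ : ∀ {x} → IntUnit x → IntUnit (x ⁻¹)
  IntUnit-⁻¹ {x} vx≡0 = +∞-inverseʳ-unique (+ 0) _ (≡.trans (≡.cong (_+∞ v (x ⁻¹)) (≡.sym vx≡0)) (v-inverse (IntUnit⇒≉0 vx≡0)))

  x*x≈1⇒IntUnit : ∀ {x} → x * x ≈ 1# → IntUnit x
  x*x≈1⇒IntUnit {x} x²≈1 with v-finite (λ x≈0 → 1≉0 (trans (sym x²≈1) (trans (*-congʳ x≈0) (zeroˡ x))))
  ... | m , vx≡m = ≡.trans vx≡m (≡.cong fin (m+m≡0⇒m≡0 m (fin-injective m+m≡0)))
    where
    m+m≡0 : fin (m ℤ.+ m) ≡ fin (+ 0)
    m+m≡0 = ≡.trans (≡.sym (v-*-fin vx≡m vx≡m)) (≡.trans (v-cong x²≈1) v-1)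
    m+m≡0⇒m≡0 : ∀ m → m ℤ.+ m ≡ + 0 → m ≡ + 0
    m+m≡0⇒m≡0 (+ k)    k+k≡0 = ≡.cong +_ (ℕ.m+n≡0⇒m≡0 k (ℤ.+-injective k+k≡0))
    m+m≡0⇒m≡0 -[1+ k ] ()

  Integral-cong : ∀ {x y} → x ≈ y → Integral x → Integral y
  Integral-cong x≈y = ≡.subst (fin (+ 0) ≤∞_) (v-cong x≈y)

  Integral-0 : Integral 0#
  Integral-0 = ≡.subst (fin (+ 0) ≤∞_) (≡.sym v-0) (_ ≤∞∞)

  Integral-1 : Integral 1#
  Integral-1 = ≡.subst (fin (+ 0) ≤∞_) (≡.sym v-1) ≤∞-refl

  IntUnit⇒Integral : ∀ {x} → IntUnit x → Integral x
  IntUnit⇒Integral vx≡0 = ≡.subst (fin (+ 0) ≤∞_) (≡.sym vx≡0) ≤∞-refl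

  Integral-ϖ : Integral ϖ
  Integral-ϖ = ≡.subst (fin (+ 0) ≤∞_) (≡.sym v-ϖ) (fin≤fin (ℤ.+≤+ ℕ.z≤n))

  Integral-+ : ∀ {x y} → Integral x → Integral y → Integral (x + y)
  Integral-+ {x} {y} 0≤x 0≤y = ≤∞-trans (min∞-glb 0≤x 0≤y) (v-add x y)

  Integral-* : ∀ {x y} → Integral x → Integral y → Integral (x * y)
  Integral-* {x} {y} 0≤x 0≤y = ≡.subst (fin (+ 0) ≤∞_) (≡.sym (v-mul x y)) (+∞-nonneg 0≤x 0≤y)

  Integral-neg : ∀ {x} → Integral x → Integral (- x)
  Integral-neg 0≤x = Integral-cong (-1*x≈-x _) (Integral-* (IntUnit⇒Integral (x*x≈1⇒IntUnit -1²≈1)) 0≤x)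
    where
    -1²≈1 : - 1# * - 1# ≈ 1#
    -1²≈1 = trans (-1*x≈-x (- 1#)) (-‿involutive 1#)

  Integral-Σᶠ : ∀ {n} {f : Fin n → Carrier} → (∀ i → Integral (f i)) → Integral (Σᶠ f)
  Integral-Σᶠ {zero}  _     = Integral-0
  Integral-Σᶠ {suc n} f-int = Integral-+ (f-int zero) (Integral-Σᶠ (f-int ∘ suc))

  IntegralMat : ∀ {n} → Mat n → Set
  IntegralMat A = ∀ i j → Integral (A i j)

  IntegralMat-· : ∀ {n} {A B : Mat n} → IntegralMat A → IntegralMat B → IntegralMat (A · B)
  IntegralMat-· A-int B-int i j = Integral-Σᶠ λ k → Integral-* (A-int i k) (B-int k j)

  IntegralMat-ᵀ : ∀ {n} {A : Mat n} → IntegralMat A → IntegralMat (A ᵀ)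
  IntegralMat-ᵀ A-int i j = A-int j i

  IntegralMat-• : ∀ {n a} {A : Mat n} → Integral a → IntegralMat A → IntegralMat (a • A)
  IntegralMat-• a-int A-int i j = Integral-* a-int (A-int i j)

  -- Identities between explicit matrices, by normalising integer polynomials

  open IntegerCoefficients cring
    using (Polynomial; ⟦_⟧; ⟦_⟧ℤ; con; var; op; _:^_; :-_; _:+_; _:*_; _:-_; [+]; [*]; prove; solve; _:=_; normalise; _≟N_; ⟦_⟧N-cong; correct)

  Integral-⟦⟧ℤ : ∀ i → Integral ⟦ i ⟧ℤ
  Integral-⟦⟧ℤ (+ n)    = ℕ-integral n
    where
    ℕ-integral : ∀ n → Integral ⟦ + n ⟧ℤ
    ℕ-integral 0             = Integral-0
    ℕ-integral 1             = Integral-1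
    ℕ-integral (suc (suc n)) = Integral-+ (ℕ-integral (suc n)) Integral-1
  Integral-⟦⟧ℤ -[1+ n ] = Integral-neg (Integral-⟦⟧ℤ (+ suc n))

  Integral-⟦⟧ : ∀ {k} (p : Polynomial k) {ρ : Vec Carrier k} →
                (∀ x → Integral (Vec.lookup ρ x)) → Integral (⟦ p ⟧ ρ)
  Integral-⟦⟧ (op [+] p q) ρ-int = Integral-+ (Integral-⟦⟧ p ρ-int) (Integral-⟦⟧ q ρ-int)
  Integral-⟦⟧ (op [*] p q) ρ-int = Integral-* (Integral-⟦⟧ p ρ-int) (Integral-⟦⟧ q ρ-int)
  Integral-⟦⟧ (con i)      ρ-int = Integral-⟦⟧ℤ i
  Integral-⟦⟧ (var x)      ρ-int = ρ-int x
  Integral-⟦⟧ (p :^ n)     ρ-int = power n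
    where
    power : ∀ n → Integral (⟦ p :^ n ⟧ _)
    power zero    = Integral-1
    power (suc n) = Integral-* (Integral-⟦⟧ p ρ-int) (power n)
  Integral-⟦⟧ (:- p)       ρ-int = Integral-neg (Integral-⟦⟧ p ρ-int)

  ⟦⟧-cong : ∀ {k} (p : Polynomial k) {ρ ρ′ : Vec Carrier k} →
            (∀ x → Vec.lookup ρ x ≈ Vec.lookup ρ′ x) → ⟦ p ⟧ ρ ≈ ⟦ p ⟧ ρ′
  ⟦⟧-cong (op [+] p q) ρ≈ρ′ = +-cong (⟦⟧-cong p ρ≈ρ′) (⟦⟧-cong q ρ≈ρ′)
  ⟦⟧-cong (op [*] p q) ρ≈ρ′ = *-cong (⟦⟧-cong p ρ≈ρ′) (⟦⟧-cong q ρ≈ρ′)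
  ⟦⟧-cong (con i)      ρ≈ρ′ = refl
  ⟦⟧-cong (var x)      ρ≈ρ′ = ρ≈ρ′ x
  ⟦⟧-cong (p :^ n)     ρ≈ρ′ = power n
    where
    power : ∀ n → ⟦ p :^ n ⟧ _ ≈ ⟦ p :^ n ⟧ _
    power zero    = refl
    power (suc n) = *-cong (⟦⟧-cong p ρ≈ρ′) (power n)
  ⟦⟧-cong (:- p)       ρ≈ρ′ = -‿cong (⟦⟧-cong p ρ≈ρ′)

  PolyMat : ℕ → ℕ → Set
  PolyMat n k = Fin n → Fin n → Polynomial k

  ⟦_⟧ₘ : ∀ {n k} → PolyMat n k → Vec Carrier k → Mat n
  ⟦ P ⟧ₘ ρ i j = ⟦ P i j ⟧ ρ

  rows : ∀ {n} → Mat n → Vec (Vec Carrier n) n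
  rows A = Vec.tabulate (λ i → Vec.tabulate (A i))

  lookup-rows : ∀ {n} (A : Mat n) i j → Vec.lookup (Vec.lookup (rows A) i) j ≡ A i j
  lookup-rows A i j = ≡.trans (≡.cong (λ r → Vec.lookup r j) (Vec.lookup∘tabulate _ i)) (Vec.lookup∘tabulate (A i) j)

  -- Stated on row vectors rather than pointwise so that, for concrete matrices, it is proved by
  -- ≡.refl: both sides then compute to the same list of entries.
  Reifies : ∀ {n k} → PolyMat n k → Vec Carrier k → Mat n → Set c
  Reifies P ρ A = rows (⟦ P ⟧ₘ ρ) ≡ rows A

  reified-entry : ∀ {n k} (P : PolyMat n k) {ρ A} → Reifies P ρ A → ∀ i j → ⟦ P i j ⟧ ρ ≡ A i j
  reified-entry P {ρ} {A} eq i j = ≡.trans (≡.sym (lookup-rows (⟦ P ⟧ₘ ρ) i j))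
    (≡.trans (≡.cong (λ r → Vec.lookup (Vec.lookup r i) j) eq) (lookup-rows A i j))

  _≟ₚ_ : ∀ {k} (p q : Polynomial k) → Maybe (∀ ρ → ⟦ p ⟧ ρ ≈ ⟦ q ⟧ ρ)
  p ≟ₚ q with normalise p ≟N normalise q
  ... | just p≈q = just λ ρ → trans (sym (correct p ρ)) (trans (⟦ p≈q ⟧N-cong ρ) (correct q ρ))
  ... | nothing  = nothing

  _≟ₘ_ : ∀ {n k} (P Q : PolyMat n k) → Maybe (∀ i j ρ → ⟦ P i j ⟧ ρ ≈ ⟦ Q i j ⟧ ρ)
  _≟ₘ_ {n} P Q = all? n λ i → all? n λ j → P i j ≟ₚ Q i j

  by-computation : ∀ {n k} (P Q : PolyMat n k) (ρ : Vec Carrier k) {A B : Mat n} →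
                   Reifies P ρ A → Reifies Q ρ B → T (is-just (P ≟ₘ Q)) → A ≈ₘ B
  by-computation P Q ρ P↦A Q↦B P≈Q i j =
    ≡.subst₂ _≈_ (reified-entry P P↦A i j) (reified-entry Q Q↦B i j) (to-witness-T (P ≟ₘ Q) P≈Q i j ρ)

  IntegralMat-by-computation : ∀ {n k} (P : PolyMat n k) {ρ : Vec Carrier k} {A : Mat n} →
                               Reifies P ρ A → (∀ x → Integral (Vec.lookup ρ x)) → IntegralMat A
  IntegralMat-by-computation P P↦A ρ-int i j =
    ≡.subst Integral (reified-entry P P↦A i j) (Integral-⟦⟧ (P i j) ρ-int)

  Σₚ : ∀ {n k} → (Fin n → Polynomial k) → Polynomial k
  Σₚ {zero}  f = con (+ 0)
  Σₚ {suc n} f = f zero :+ Σₚ (f ∘ suc)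

  infixl 7 _·ₚ_ _•ₚ_

  _·ₚ_ : ∀ {n k} → PolyMat n k → PolyMat n k → PolyMat n k
  (P ·ₚ Q) i j = Σₚ (λ l → P i l :* Q l j)

  _ᵀₚ : ∀ {n k} → PolyMat n k → PolyMat n k
  (P ᵀₚ) i j = P j i

  _•ₚ_ : ∀ {n k} → Polynomial k → PolyMat n k → PolyMat n k
  (p •ₚ P) i j = p :* P i j

  δₚ : ∀ {n k} → PolyMat n k
  δₚ i j with i Fin.≟ j
  ... | yes _ = con (+ 1)
  ... | no  _ = con (+ 0)

  Jₚ : ∀ {k} n → PolyMat (n ℕ.+ n) k
  Jₚ n i j with splitAt n i | splitAt n j
  ... | inj₁ a | inj₂ b = δₚ a b
  ... | inj₂ a | inj₁ b = :- δₚ a b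
  ... | _      | _      = con (+ 0)

  embedₚ : ∀ {k} → PolyMat 2 k → PolyMat 4 k → PolyMat 6 k
  embedₚ A M i j with ι i | ι j
  ... | inj₁ a | inj₁ b = A a b
  ... | inj₂ a | inj₂ b = M a b
  ... | _      | _      = con (+ 0)

  entries : ∀ {n} → Mat n → Vec Carrier (n ℕ.* n)
  entries {n} A = Vec.tabulate λ k → A (Fin.quotient n k) (Fin.remainder {n} n k)

  vars : ∀ {n} → PolyMat n (n ℕ.* n)
  vars i j = var (combine i j)

  det₂ₚ : ∀ {k} → PolyMat 2 k → Polynomial k
  det₂ₚ P = P f0 f0 :* P f1 f1 :- P f0 f1 :* P f1 f0

  Jᵀ·J≈1 : J 3 ᵀ · J 3 ≈ₘ 1ₘ
  Jᵀ·J≈1 = by-computation (Jₚ 3 ᵀₚ ·ₚ Jₚ 3) δₚ [] ≡.refl ≡.refl _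

  IntegralMat-J : IntegralMat (J 3)
  IntegralMat-J = IntegralMat-by-computation (Jₚ 3) {[]} ≡.refl λ ()

  IntegralMat-1 : IntegralMat {6} 1ₘ
  IntegralMat-1 = IntegralMat-by-computation δₚ {[]} ≡.refl λ ()

  IsSim-1 : IsSim 3 1ₘ 1#
  IsSim-1 = by-computation (δₚ ᵀₚ ·ₚ Jₚ 3 ·ₚ δₚ) (con (+ 1) •ₚ Jₚ 3) [] ≡.refl ≡.refl _

  det₂-· : ∀ (A B : Mat 2) → det₂ (A · B) ≈ det₂ A * det₂ B
  det₂-· A B = prove (entries A ++ entries B) (det₂ₚ (Aₚ ·ₚ Bₚ)) (det₂ₚ Aₚ :* det₂ₚ Bₚ) refl
    where
    Aₚ Bₚ : PolyMat 2 8
    Aₚ i j = var (combine i j ↑ˡ 4)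
    Bₚ i j = var (4 ↑ʳ combine i j)

  GL₂-form : ∀ (A : Mat 2) → A ᵀ · J 1 · A ≈ₘ det₂ A • J 1
  GL₂-form A = by-computation (vars ᵀₚ ·ₚ Jₚ 1 ·ₚ vars) (det₂ₚ vars •ₚ Jₚ 1) (entries A) ≡.refl ≡.refl _

  embed-J : ∀ μ → embed (μ • J 1) (μ • J 2) ≈ₘ μ • J 3
  embed-J μ = by-computation (embedₚ (var zero •ₚ Jₚ 1) (var zero •ₚ Jₚ 2)) (var zero •ₚ Jₚ 3) (μ ∷ []) ≡.refl ≡.refl _

  IsSim-resp : ∀ {n} {g g′ : Mat (n ℕ.+ n)} {μ μ′} → g ≈ₘ g′ → μ ≈ μ′ → IsSim n g μ → IsSim n g′ μ′
  IsSim-resp {n} {g} {g′} {μ} {μ′} g≈g′ μ≈μ′ sim = begin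
    g′ ᵀ · J n · g′ ≈⟨ ·-cong (·-congʳ (J n) (λ i j → sym (g≈g′ j i))) (≈ₘ.sym g≈g′) ⟩
    g ᵀ · J n · g   ≈⟨ sim ⟩
    μ • J n         ≈⟨ (λ i j → *-congʳ μ≈μ′) ⟩
    μ′ • J n        ∎
    where open ≈ₘ-Reasoning

  IsSim-· : ∀ {n} {a b : Mat (n ℕ.+ n)} {α β} → IsSim n a α → IsSim n b β → IsSim n (a · b) (α * β)
  IsSim-· {n} {a} {b} {α} {β} sim-a sim-b = begin
    (a · b) ᵀ · J n · (a · b)   ≈⟨ ·-congʳ (a · b) (·-congʳ (J n) (ᵀ-· a b)) ⟩
    b ᵀ · a ᵀ · J n · (a · b)   ≈⟨ ·-assoc (b ᵀ · a ᵀ · J n) a b ⟨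
    b ᵀ · a ᵀ · J n · a · b     ≈⟨ ·-congʳ b (·-congʳ a (·-assoc (b ᵀ) (a ᵀ) (J n))) ⟩
    b ᵀ · (a ᵀ · J n) · a · b   ≈⟨ ·-congʳ b (·-assoc (b ᵀ) (a ᵀ · J n) a) ⟩
    b ᵀ · (a ᵀ · J n · a) · b   ≈⟨ ·-congʳ b (·-congˡ (b ᵀ) sim-a) ⟩
    b ᵀ · (α • J n) · b         ≈⟨ ·-congʳ b (•-·ʳ α (b ᵀ) (J n)) ⟩
    α • (b ᵀ · J n) · b         ≈⟨ •-·ˡ α (b ᵀ · J n) b ⟩
    α • (b ᵀ · J n · b)         ≈⟨ •-congˡ α sim-b ⟩
    α • (β • J n)               ≈⟨ •-• α β (J n) ⟩
    (α * β) • J n               ∎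
    where open ≈ₘ-Reasoning

  IsSim-unique : ∀ {g α β} → IsSim 3 g α → IsSim 3 g β → α ≈ β
  IsSim-unique {α = α} {β} sim-α sim-β =
    trans (sym (*-identityʳ α)) (trans (sym (sim-α f0 f3)) (trans (sim-β f0 f3) (*-identityʳ β)))

  IsSim-leftInverse : ∀ {k ν} → ¬ ν ≈ 0# → IsSim 3 k ν → (ν ⁻¹) • (J 3 ᵀ · k ᵀ · J 3) · k ≈ₘ 1ₘ
  IsSim-leftInverse {k} {ν} ν≉0 sim = begin
    (ν ⁻¹) • (J 3 ᵀ · k ᵀ · J 3) · k      ≈⟨ •-·ˡ (ν ⁻¹) (J 3 ᵀ · k ᵀ · J 3) k ⟩
    (ν ⁻¹) • (J 3 ᵀ · k ᵀ · J 3 · k)      ≈⟨ •-congˡ (ν ⁻¹) (·-assoc (J 3 ᵀ · k ᵀ) (J 3) k) ⟩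
    (ν ⁻¹) • (J 3 ᵀ · k ᵀ · (J 3 · k))    ≈⟨ •-congˡ (ν ⁻¹) (·-assoc (J 3 ᵀ) (k ᵀ) (J 3 · k)) ⟩
    (ν ⁻¹) • (J 3 ᵀ · (k ᵀ · (J 3 · k)))  ≈⟨ •-congˡ (ν ⁻¹) (·-congˡ (J 3 ᵀ) (·-assoc (k ᵀ) (J 3) k)) ⟨
    (ν ⁻¹) • (J 3 ᵀ · (k ᵀ · J 3 · k))    ≈⟨ •-congˡ (ν ⁻¹) (·-congˡ (J 3 ᵀ) sim) ⟩
    (ν ⁻¹) • (J 3 ᵀ · (ν • J 3))          ≈⟨ •-congˡ (ν ⁻¹) (•-·ʳ ν (J 3 ᵀ) (J 3)) ⟩
    (ν ⁻¹) • (ν • (J 3 ᵀ · J 3))          ≈⟨ •-• (ν ⁻¹) ν (J 3 ᵀ · J 3) ⟩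
    (ν ⁻¹ * ν) • (J 3 ᵀ · J 3)          ≈⟨ •-cong (trans (*-comm _ _) (⁻¹-inverse ν ν≉0)) Jᵀ·J≈1 ⟩
    1# • 1ₘ                             ≈⟨ (λ i j → *-identityˡ _) ⟩
    1ₘ                                  ∎
    where open ≈ₘ-Reasoning

  ι⁻¹ : Fin 2 ⊎ Fin 4 → Fin 6
  ι⁻¹ (inj₁ f0) = f0
  ι⁻¹ (inj₁ f1) = f3
  ι⁻¹ (inj₂ f0) = f1
  ι⁻¹ (inj₂ f1) = f2
  ι⁻¹ (inj₂ f2) = f4
  ι⁻¹ (inj₂ f3) = f5

  ι-ι⁻¹ : ∀ x → ι (ι⁻¹ x) ≡ x
  ι-ι⁻¹ (inj₁ f0) = ≡.refl
  ι-ι⁻¹ (inj₁ f1) = ≡.refl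
  ι-ι⁻¹ (inj₂ f0) = ≡.refl
  ι-ι⁻¹ (inj₂ f1) = ≡.refl
  ι-ι⁻¹ (inj₂ f2) = ≡.refl
  ι-ι⁻¹ (inj₂ f3) = ≡.refl

  Σᶠ-ι : ∀ (f : Fin 6 → Carrier) → Σᶠ f ≈ Σᶠ (f ∘ ι⁻¹ ∘ inj₁) + Σᶠ (f ∘ ι⁻¹ ∘ inj₂)
  Σᶠ-ι f = prove (Vec.tabulate f) (Σₚ var) (Σₚ (var ∘ ι⁻¹ ∘ inj₁) :+ Σₚ (var ∘ ι⁻¹ ∘ inj₂)) refl

  block : Mat 2 → Mat 4 → Fin 2 ⊎ Fin 4 → Fin 2 ⊎ Fin 4 → Carrier
  block A M (inj₁ a) (inj₁ b) = A a b
  block A M (inj₂ a) (inj₂ b) = M a b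
  block A M _        _        = 0#

  embed-block : ∀ A M i j → embed A M i j ≡ block A M (ι i) (ι j)
  embed-block A M i j with ι i | ι j
  ... | inj₁ a | inj₁ b = ≡.refl
  ... | inj₁ a | inj₂ b = ≡.refl
  ... | inj₂ a | inj₁ b = ≡.refl
  ... | inj₂ a | inj₂ b = ≡.refl

  embed-ι⁻¹ : ∀ A M x y → embed A M (ι⁻¹ x) (ι⁻¹ y) ≡ block A M x y
  embed-ι⁻¹ A M x y = ≡.trans (embed-block A M (ι⁻¹ x) (ι⁻¹ y)) (≡.cong₂ (block A M) (ι-ι⁻¹ x) (ι-ι⁻¹ y))

  block-· : ∀ A M B N x y →
            Σᶠ (λ a → block A M x (inj₁ a) * block B N (inj₁ a) y) +
            Σᶠ (λ b → block A M x (inj₂ b) * block B N (inj₂ b) y) ≈ block (A · B) (M · N) x y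
  block-· A M B N (inj₁ a) (inj₁ b) = trans (+-congˡ (Σᶠ-zero {4} λ _ → zeroˡ 0#)) (+-identityʳ _)
  block-· A M B N (inj₁ a) (inj₂ b) = trans (+-cong (Σᶠ-zero {2} λ k → zeroʳ (A a k)) (Σᶠ-zero {4} λ k → zeroˡ (N k b))) (+-identityʳ 0#)
  block-· A M B N (inj₂ a) (inj₁ b) = trans (+-cong (Σᶠ-zero {2} λ k → zeroˡ (B k b)) (Σᶠ-zero {4} λ k → zeroʳ (M a k))) (+-identityʳ 0#)
  block-· A M B N (inj₂ a) (inj₂ b) = trans (+-congʳ (Σᶠ-zero {2} λ _ → zeroˡ 0#)) (+-identityˡ _)

  embed-· : ∀ A M B N → embed A M · embed B N ≈ₘ embed (A · B) (M · N)
  embed-· A M B N i j = begin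
    Σᶠ (λ k → E k)                                                ≈⟨ Σᶠ-ι E ⟩
    Σᶠ (E ∘ ι⁻¹ ∘ inj₁) + Σᶠ (E ∘ ι⁻¹ ∘ inj₂)                     ≈⟨ +-cong (Σᶠ-cong (entry ∘ inj₁)) (Σᶠ-cong (entry ∘ inj₂)) ⟩
    Σᶠ (λ a → block A M (ι i) (inj₁ a) * block B N (inj₁ a) (ι j)) +
    Σᶠ (λ b → block A M (ι i) (inj₂ b) * block B N (inj₂ b) (ι j)) ≈⟨ block-· A M B N (ι i) (ι j) ⟩
    block (A · B) (M · N) (ι i) (ι j)                             ≡⟨ embed-block (A · B) (M · N) i j ⟨
    embed (A · B) (M · N) i j                                     ∎
    where
    open ≈-Reasoning
    E : Fin 6 → Carrier
    E k = embed A M i k * embed B N k j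
    entry : ∀ x → E (ι⁻¹ x) ≈ block A M (ι i) x * block B N x (ι j)
    entry x = reflexive (≡.cong₂ _*_
      (≡.trans (embed-block A M i (ι⁻¹ x)) (≡.cong (block A M (ι i)) (ι-ι⁻¹ x)))
      (≡.trans (embed-block B N (ι⁻¹ x) j) (≡.cong (λ z → block B N z (ι j)) (ι-ι⁻¹ x))))

  embed-ᵀ : ∀ A M → embed A M ᵀ ≈ₘ embed (A ᵀ) (M ᵀ)
  embed-ᵀ A M i j = reflexive (≡.trans (embed-block A M j i)
    (≡.trans (block-ᵀ (ι j) (ι i)) (≡.sym (embed-block (A ᵀ) (M ᵀ) i j))))
    where
    block-ᵀ : ∀ x y → block A M x y ≡ block (A ᵀ) (M ᵀ) y x
    block-ᵀ (inj₁ a) (inj₁ b) = ≡.refl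
    block-ᵀ (inj₁ a) (inj₂ b) = ≡.refl
    block-ᵀ (inj₂ a) (inj₁ b) = ≡.refl
    block-ᵀ (inj₂ a) (inj₂ b) = ≡.refl

  embed-cong : ∀ {A A′ M M′} → A ≈ₘ A′ → M ≈ₘ M′ → embed A M ≈ₘ embed A′ M′
  embed-cong {A} {A′} {M} {M′} A≈A′ M≈M′ i j =
    ≡.subst₂ _≈_ (≡.sym (embed-block A M i j)) (≡.sym (embed-block A′ M′ i j)) (block-cong (ι i) (ι j))
    where
    block-cong : ∀ x y → block A M x y ≈ block A′ M′ x y
    block-cong (inj₁ a) (inj₁ b) = A≈A′ a b
    block-cong (inj₁ a) (inj₂ b) = refl
    block-cong (inj₂ a) (inj₁ b) = refl
    block-cong (inj₂ a) (inj₂ b) = M≈M′ a b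

  J-embed : J 3 ≈ₘ embed (J 1) (J 2)
  J-embed = by-computation (Jₚ 3) (embedₚ (Jₚ 1) (Jₚ 2)) [] ≡.refl ≡.refl _

  IsSim-embed : ∀ {A M μ} → det₂ A ≈ μ → IsSim 2 M μ → IsSim 3 (embed A M) μ
  IsSim-embed {A} {M} {μ} detA≈μ sim-M = begin
    embed A M ᵀ · J 3 · embed A M                     ≈⟨ ·-congʳ (embed A M) (·-cong (embed-ᵀ A M) J-embed) ⟩
    embed (A ᵀ) (M ᵀ) · embed (J 1) (J 2) · embed A M ≈⟨ ·-congʳ (embed A M) (embed-· (A ᵀ) (M ᵀ) (J 1) (J 2)) ⟩
    embed (A ᵀ · J 1) (M ᵀ · J 2) · embed A M         ≈⟨ embed-· (A ᵀ · J 1) (M ᵀ · J 2) A M ⟩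
    embed (A ᵀ · J 1 · A) (M ᵀ · J 2 · M)             ≈⟨ embed-cong (λ i j → trans (GL₂-form A i j) (*-congʳ detA≈μ)) sim-M ⟩
    embed (μ • J 1) (μ • J 2)                         ≈⟨ embed-J μ ⟩
    μ • J 3                                           ∎
    where open ≈ₘ-Reasoning

  det₂-cong : ∀ {A B} → A ≈ₘ B → det₂ A ≈ det₂ B
  det₂-cong A≈B = +-cong (*-cong (A≈B f0 f0) (A≈B f1 f1)) (-‿cong (*-cong (A≈B f0 f1) (A≈B f1 f0)))

  -- Rows 0, 3 are the coordinates of the GL₂ factor of H′.
  GL₂-rows : Fin 6 → Fin 6 → Mat 6 → Mat 2
  GL₂-rows c d X a f0 = X (ι⁻¹ (inj₁ a)) c
  GL₂-rows c d X a f1 = X (ι⁻¹ (inj₁ a)) d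

  GL₂-rows-cong : ∀ c d {X Y} → X ≈ₘ Y → GL₂-rows c d X ≈ₘ GL₂-rows c d Y
  GL₂-rows-cong c d X≈Y a f0 = X≈Y (ι⁻¹ (inj₁ a)) c
  GL₂-rows-cong c d X≈Y a f1 = X≈Y (ι⁻¹ (inj₁ a)) d

  IntegralMat-GL₂-rows : ∀ c d {X} → IntegralMat X → IntegralMat (GL₂-rows c d X)
  IntegralMat-GL₂-rows c d X-int a f0 = X-int (ι⁻¹ (inj₁ a)) c
  IntegralMat-GL₂-rows c d X-int a f1 = X-int (ι⁻¹ (inj₁ a)) d

  Integral-det₂ : ∀ {A} → IntegralMat A → Integral (det₂ A)
  Integral-det₂ A-int = Integral-+ (Integral-* (A-int f0 f0) (A-int f1 f1)) (Integral-neg (Integral-* (A-int f0 f1) (A-int f1 f0)))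

  embed-·-GL₂-row : ∀ A M W a l → (embed A M · W) (ι⁻¹ (inj₁ a)) l ≈ Σᶠ (λ b → A a b * W (ι⁻¹ (inj₁ b)) l)
  embed-·-GL₂-row A M W a l = begin
    Σᶠ E                                        ≈⟨ Σᶠ-ι E ⟩
    Σᶠ (E ∘ ι⁻¹ ∘ inj₁) + Σᶠ (E ∘ ι⁻¹ ∘ inj₂)   ≈⟨ +-cong (Σᶠ-cong (entry ∘ inj₁)) (Σᶠ-zero λ b → trans (entry (inj₂ b)) (zeroˡ _)) ⟩
    Σᶠ (λ b → A a b * W (ι⁻¹ (inj₁ b)) l) + 0#  ≈⟨ +-identityʳ _ ⟩
    Σᶠ (λ b → A a b * W (ι⁻¹ (inj₁ b)) l)       ∎
    where
    open ≈-Reasoning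
    E : Fin 6 → Carrier
    E k = embed A M (ι⁻¹ (inj₁ a)) k * W k l
    entry : ∀ x → E (ι⁻¹ x) ≈ block A M (inj₁ a) x * W (ι⁻¹ x) l
    entry x = reflexive (≡.cong (_* W (ι⁻¹ x) l) (embed-ι⁻¹ A M (inj₁ a) x))

  GL₂-rows-embed-· : ∀ c d A M W → GL₂-rows c d (embed A M · W) ≈ₘ A · GL₂-rows c d W
  GL₂-rows-embed-· c d A M W a f0 = embed-·-GL₂-row A M W a c
  GL₂-rows-embed-· c d A M W a f1 = embed-·-GL₂-row A M W a d

  det₂-GL₂-rows-embed-· : ∀ c d A M W → det₂ (GL₂-rows c d (embed A M · W)) ≈ det₂ A * det₂ (GL₂-rows c d W)
  det₂-GL₂-rows-embed-· c d A M W = trans (det₂-cong (GL₂-rows-embed-· c d A M W)) (det₂-· A (GL₂-rows c d W))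

  -- Over a field, a left inverse of a square matrix is a right inverse

  combination : ∀ {m n} → (Fin m → Carrier) → (Fin m → Fin n → Carrier) → Fin n → Carrier
  combination κ u r = Σᶠ (λ i → κ i * u i r)

  LinearlyDependent : ∀ {m n} → (Fin m → Fin n → Carrier) → Set (c ⊔ ℓ)
  LinearlyDependent u = ∃ λ κ → (∃ λ i → ¬ κ i ≈ 0#) × (∀ r → combination κ u r ≈ 0#)

  module +-group = Algebra.Properties.Group +-group

  d[x-yt]≈dx-[dy]t : ∀ d x y t → d * (x - y * t) ≈ d * x - (d * y) * t
  d[x-yt]≈dx-[dy]t = solve 4 (λ d x y t → d :* (x :- y :* t) := d :* x :- (d :* y) :* t) refl

  Σᶠ-elimination : ∀ {n} (κ x y : Fin n → Carrier) t →
                   Σᶠ (λ i → κ i * (x i - y i * t)) ≈ Σᶠ (λ i → κ i * x i) - Σᶠ (λ i → κ i * y i) * t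
  Σᶠ-elimination {n} κ x y t = begin
    Σᶠ (λ i → κ i * (x i - y i * t))                       ≈⟨ Σᶠ-cong (λ i → d[x-yt]≈dx-[dy]t (κ i) (x i) (y i) t) ⟩
    Σᶠ (λ i → κ i * x i - κ i * y i * t)                   ≈⟨ Σᶠ-+ {n} _ _ ⟩
    Σᶠ (λ i → κ i * x i) + Σᶠ (λ i → - (κ i * y i * t))    ≈⟨ +-congˡ (Σᶠ-neg {n} _) ⟩
    Σᶠ (λ i → κ i * x i) - Σᶠ (λ i → κ i * y i * t)        ≈⟨ +-congˡ (-‿cong (*-distribʳ-Σᶠ {n} t _)) ⟨
    Σᶠ (λ i → κ i * x i) - Σᶠ (λ i → κ i * y i) * t        ∎
    where open ≈-Reasoning

  dependent-zero-column : ∀ {n} (u : Fin (suc (suc n)) → Fin (suc n) → Carrier) → (∀ i → u i zero ≈ 0#) →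
                          LinearlyDependent (λ i r → u (suc i) (suc r)) → LinearlyDependent u
  dependent-zero-column u u-zero (κ , (i , κi≉0) , κ-dep) = 0# ∷ᶠ κ , (suc i , κi≉0) , dep
    where
    dep : ∀ r → combination (0# ∷ᶠ κ) u r ≈ 0#
    dep zero    = trans (+-cong (zeroˡ _) (Σᶠ-zero λ i → trans (*-congˡ (u-zero (suc i))) (zeroʳ (κ i)))) (+-identityˡ 0#)
    dep (suc r) = trans (+-cong (zeroˡ _) (κ-dep r)) (+-identityˡ 0#)

  -- One step of Gaussian elimination, clearing the first coordinate with the pivot u j zero.
  module Pivot {n} (u : Fin (suc (suc n)) → Fin (suc n) → Carrier) (j : Fin (suc (suc n))) (b≉0 : ¬ u j zero ≈ 0#) where

    b : Carrier
    b = u j zero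

    factor : Fin (suc n) → Carrier
    factor i = u (punchIn j i) zero * b ⁻¹

    eliminated : Fin (suc n) → Fin n → Carrier
    eliminated i r = u (punchIn j i) (suc r) - factor i * u j (suc r)

    dependent-pivot : LinearlyDependent eliminated → LinearlyDependent u
    dependent-pivot (κ , (i , κi≉0) , κ-dep) = κ′ , (punchIn j i , ≢0) , dep
      where
      S = Σᶠ (λ i → κ i * factor i)
      κ′ = insertAt κ j (- S)
      ≢0 : ¬ κ′ (punchIn j i) ≈ 0#
      ≢0 = ≡.subst (λ x → ¬ x ≈ 0#) (≡.sym (insertAt-punchIn κ j (- S) i)) κi≉0
      split : ∀ r → combination κ′ u r ≈ - S * u j r + Σᶠ (λ i → κ i * u (punchIn j i) r)
      split r = trans (Σᶠ-punchIn j (λ k → κ′ k * u k r))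
        (+-cong (reflexive (≡.cong (_* u j r) (insertAt-lookup κ j (- S))))
                (Σᶠ-cong λ i → reflexive (≡.cong (_* u (punchIn j i) r) (insertAt-punchIn κ j (- S) i))))
      S*b : S * b ≈ Σᶠ (λ i → κ i * u (punchIn j i) zero)
      S*b = trans (*-distribʳ-Σᶠ b (λ i → κ i * factor i)) (Σᶠ-cong λ i → begin
        κ i * (u (punchIn j i) zero * b ⁻¹) * b   ≈⟨ *-assoc _ _ _ ⟩
        κ i * (u (punchIn j i) zero * b ⁻¹ * b)   ≈⟨ *-congˡ (*-assoc _ _ _) ⟩
        κ i * (u (punchIn j i) zero * (b ⁻¹ * b)) ≈⟨ *-congˡ (*-congˡ (trans (*-comm _ _) (⁻¹-inverse b b≉0))) ⟩
        κ i * (u (punchIn j i) zero * 1#)         ≈⟨ *-congˡ (*-identityʳ _) ⟩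
        κ i * u (punchIn j i) zero                ∎)
        where open ≈-Reasoning
      dep : ∀ r → combination κ′ u r ≈ 0#
      dep zero = begin
        combination κ′ u zero                                  ≈⟨ split zero ⟩
        - S * b + Σᶠ (λ i → κ i * u (punchIn j i) zero)       ≈⟨ +-congʳ (sym (-‿distribˡ-* S b)) ⟩
        - (S * b) + Σᶠ (λ i → κ i * u (punchIn j i) zero)     ≈⟨ +-congʳ (-‿cong S*b) ⟩
        - Σᶠ (λ i → κ i * u (punchIn j i) zero) + Σᶠ (λ i → κ i * u (punchIn j i) zero) ≈⟨ -‿inverseˡ _ ⟩
        0#                                                     ∎
        where open ≈-Reasoning
      dep (suc r) = begin
        combination κ′ u (suc r)                          ≈⟨ split (suc r) ⟩
        - S * t + Σᶠ (λ i → κ i * u (punchIn j i) (suc r)) ≈⟨ +-congʳ (sym (-‿distribˡ-* S t)) ⟩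
        - (S * t) + Σᶠ (λ i → κ i * u (punchIn j i) (suc r)) ≈⟨ +-comm _ _ ⟩
        Σᶠ (λ i → κ i * u (punchIn j i) (suc r)) - S * t  ≈⟨ Σᶠ-elimination κ (λ i → u (punchIn j i) (suc r)) factor t ⟨
        combination κ eliminated r                        ≈⟨ κ-dep r ⟩
        0#                                                ∎
        where
        open ≈-Reasoning
        t = u j (suc r)

  linearly-dependent : ∀ n (u : Fin (suc n) → Fin n → Carrier) → LinearlyDependent u
  linearly-dependent zero    u = (λ _ → 1#) , (zero , 1≉0) , λ ()
  linearly-dependent (suc n) u with Fin.any? (λ i → ¬? (u i zero ≟0))
  ... | yes (j , b≉0) = Pivot.dependent-pivot u j b≉0 (linearly-dependent n (Pivot.eliminated u j b≉0))
  ... | no no-pivot   = dependent-zero-column u u-zero (linearly-dependent n (λ i r → u (suc i) (suc r)))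
    where
    u-zero : ∀ i → u i zero ≈ 0#
    u-zero i with u i zero ≟0
    ... | yes ui≈0 = ui≈0
    ... | no  ui≉0 = ⊥-elim (no-pivot (i , ui≉0))

  columns : ∀ {n} → Mat n → Fin n → Fin n → Carrier
  columns A l r = A r l

  left-invertible⇒columns-independent : ∀ {n} {A B : Mat n} → B · A ≈ₘ 1ₘ → ∀ κ →
    (∀ r → combination κ (columns A) r ≈ 0#) → ∀ s → κ s ≈ 0#
  left-invertible⇒columns-independent {n} {A} {B} B·A≈1 κ κ-dep s = begin
    κ s                                                  ≈⟨ Σᶠ-δˡ s κ ⟨
    Σᶠ (λ l → δ s l * κ l)                               ≈⟨ Σᶠ-cong {n} (λ l → *-congʳ (sym (B·A≈1 s l))) ⟩
    Σᶠ (λ l → Σᶠ (λ r → B s r * A r l) * κ l)            ≈⟨ Σᶠ-cong {n} (λ l → *-distribʳ-Σᶠ {n} (κ l) (λ r → B s r * A r l)) ⟩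
    Σᶠ (λ l → Σᶠ (λ r → B s r * A r l * κ l))            ≈⟨ Σᶠ-swap {n} {n} _ ⟩
    Σᶠ (λ r → Σᶠ (λ l → B s r * A r l * κ l))            ≈⟨ Σᶠ-cong {n} (λ r → Σᶠ-cong {n} λ l → trans (*-assoc _ _ _) (*-congˡ (*-comm _ _))) ⟩
    Σᶠ (λ r → Σᶠ (λ l → B s r * (κ l * A r l)))          ≈⟨ Σᶠ-cong {n} (λ r → *-distribˡ-Σᶠ {n} (B s r) (λ l → κ l * A r l)) ⟨
    Σᶠ (λ r → B s r * combination κ (columns A) r)       ≈⟨ Σᶠ-zero {n} (λ r → trans (*-congˡ (κ-dep r)) (zeroʳ _)) ⟩
    0#                                                   ∎
    where open ≈-Reasoning

  left-invertible⇒solvable : ∀ {n} {A B : Mat n} → B · A ≈ₘ 1ₘ →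
    ∀ z → ∃ λ w → ∀ r → Σᶠ (λ l → A r l * w l) ≈ z r
  left-invertible⇒solvable {n} {A} B·A≈1 z with linearly-dependent n (z ∷ᶠ columns A)
  ... | κ , (i , κi≉0) , κ-dep with κ zero ≟0
  ...   | no κ₀≉0 = w , solves
    where
    rest : ∀ r → combination (κ ∘ suc) (columns A) r ≈ - (κ zero * z r)
    rest r = +-group.inverseʳ-unique _ _ (κ-dep r)
    q = κ zero ⁻¹
    w : Fin n → Carrier
    w l = - (q * κ (suc l))
    a[-qk]≈-q[ka] : ∀ a k → a * - (q * k) ≈ - (q * (k * a))
    a[-qk]≈-q[ka] = solve 3 (λ q a k → a :* :- (q :* k) := :- (q :* (k :* a))) refl q
    solves : ∀ r → Σᶠ (λ l → A r l * w l) ≈ z r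
    solves r = begin
      Σᶠ (λ l → A r l * - (q * κ (suc l)))                  ≈⟨ Σᶠ-cong {n} (λ l → a[-qk]≈-q[ka] (A r l) (κ (suc l))) ⟩
      Σᶠ (λ l → - (q * (κ (suc l) * A r l)))                ≈⟨ Σᶠ-neg {n} _ ⟩
      - Σᶠ (λ l → q * (κ (suc l) * A r l))                  ≈⟨ -‿cong (*-distribˡ-Σᶠ {n} q _) ⟨
      - (q * combination (κ ∘ suc) (columns A) r)            ≈⟨ -‿cong (*-congˡ (rest r)) ⟩
      - (q * - (κ zero * z r))                              ≈⟨ -‿cong (sym (-‿distribʳ-* q _)) ⟩
      - - (q * (κ zero * z r))                              ≈⟨ -‿involutive _ ⟩
      q * (κ zero * z r)                                    ≈⟨ *-assoc _ _ _ ⟨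
      q * κ zero * z r                                      ≈⟨ *-congʳ (trans (*-comm _ _) (⁻¹-inverse _ κ₀≉0)) ⟩
      1# * z r                                              ≈⟨ *-identityˡ _ ⟩
      z r                                                   ∎
      where open ≈-Reasoning
  ...   | yes κ₀≈0 = ⊥-elim (κi≉0 (κ≈0 i))
    where
    rest≈0 : ∀ r → combination (κ ∘ suc) (columns A) r ≈ 0#
    rest≈0 r = trans (+-group.inverseʳ-unique _ _ (κ-dep r)) (trans (-‿cong (trans (*-congʳ κ₀≈0) (zeroˡ _))) -0#≈0#)
    κ≈0 : ∀ i → κ i ≈ 0#
    κ≈0 zero    = κ₀≈0
    κ≈0 (suc s) = left-invertible⇒columns-independent B·A≈1 (κ ∘ suc) rest≈0 s

  left-inverse⇒right-inverse : ∀ {n} {A B : Mat n} → B · A ≈ₘ 1ₘ → A · B ≈ₘ 1ₘ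
  left-inverse⇒right-inverse {n} {A} {B} B·A≈1 = begin
    A · B                ≈⟨ ·-identityʳ (A · B) ⟨
    A · B · 1ₘ           ≈⟨ ·-congˡ (A · B) A·W≈1 ⟨
    A · B · (A · W)      ≈⟨ ·-assoc A B (A · W) ⟩
    A · (B · (A · W))    ≈⟨ ·-congˡ A (·-assoc B A W) ⟨
    A · (B · A · W)      ≈⟨ ·-congˡ A (·-congʳ W B·A≈1) ⟩
    A · (1ₘ · W)         ≈⟨ ·-congˡ A (·-identityˡ W) ⟩
    A · W                ≈⟨ A·W≈1 ⟩
    1ₘ                   ∎
    where
    open ≈ₘ-Reasoning
    W : Mat n
    W l t = proj₁ (left-invertible⇒solvable B·A≈1 (λ r → δ r t)) l
    A·W≈1 : A · W ≈ₘ 1ₘ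
    A·W≈1 r t = proj₂ (left-invertible⇒solvable B·A≈1 (λ r → δ r t)) r

  -- The double coset invariant

  K-right-inverse : ∀ {k} → InK k → ∃ λ L → IntegralMat L × k · L ≈ₘ 1ₘ
  K-right-inverse {k} (k-int , ν , ν-unit , sim) =
    L , L-int , left-inverse⇒right-inverse {A = k} {L} (IsSim-leftInverse {k} (IntUnit⇒≉0 ν-unit) sim)
    where
    L = (ν ⁻¹) • (J 3 ᵀ · k ᵀ · J 3)
    L-int : IntegralMat L
    L-int = IntegralMat-• (IntUnit⇒Integral (IntUnit-⁻¹ ν-unit))
              (IntegralMat-· (IntegralMat-· (IntegralMat-ᵀ IntegralMat-J) (IntegralMat-ᵀ k-int)) IntegralMat-J)

  IsSim-double-coset : ∀ {A M μ x μx k ν g h} → h ≈ₘ embed A M → det₂ A ≈ μ → IsSim 2 M μ →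
                       IsSim 3 x μx → IsSim 3 k ν → g ≈ₘ h · x · k → IsSim 3 g (μ * μx * ν)
  IsSim-double-coset {A} {M} {μ} {x} {μx} {k} {ν} {g} {h} h≈ detA≈μ sim-M sim-x sim-k g≈ =
    IsSim-resp {3} {h · x · k} {g} (≈ₘ.sym g≈) refl (IsSim-· {3} {h · x} {k} (IsSim-· {3} {h} {x} sim-h sim-x) sim-k)
    where
    sim-h : IsSim 3 h μ
    sim-h = IsSim-resp {3} {embed A M} {h} (≈ₘ.sym h≈) refl (IsSim-embed detA≈μ sim-M)

  v-*-unit : ∀ x y {ν} → IntUnit ν → v (x * y * ν) ≡ v x +∞ v y
  v-*-unit x y {ν} ν-unit = ≡.trans (v-mul (x * y) ν)
    (≡.trans (≡.cong₂ _+∞_ (v-mul x y) ν-unit) (+∞-identityʳ (v x +∞ v y)))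

  valuation-bound : ∀ {μ₀ μ₁ ν₀ ν₁ μx μy m m′} → ¬ μ₁ ≈ 0# → IntUnit ν₀ → IntUnit ν₁ → Integral m′ →
                    μ₀ * μx * ν₀ ≈ μ₁ * μy * ν₁ → μ₁ * m ≈ μ₀ * m′ → v μy ≤∞ v μx +∞ v m
  valuation-bound {μ₀} {μ₁} {ν₀} {ν₁} {μx} {μy} {m} {m′} μ₁≉0 ν₀-unit ν₁-unit m′-int multipliers minors
    with v-finite μ₁≉0
  ... | a , vμ₁≡a = +∞-cancelˡ-≤ a (begin
    fin a +∞ v μy             ≡⟨ ≡.cong (_+∞ v μy) vμ₁≡a ⟨
    v μ₁ +∞ v μy              ≡⟨ v-*-unit μ₁ μy ν₁-unit ⟨
    v (μ₁ * μy * ν₁)          ≡⟨ v-cong multipliers ⟨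
    v (μ₀ * μx * ν₀)          ≡⟨ v-*-unit μ₀ μx ν₀-unit ⟩
    v μ₀ +∞ v μx              ≡⟨ +∞-comm (v μ₀) (v μx) ⟩
    v μx +∞ v μ₀              ≲⟨ +∞-monoʳ-≤ (v μx) (x≤∞x+∞y (v μ₀) m′-int) ⟩
    v μx +∞ (v μ₀ +∞ v m′)    ≡⟨ ≡.cong (v μx +∞_) v-minors ⟨
    v μx +∞ (fin a +∞ v m)    ≡⟨ +∞-assoc (v μx) (fin a) (v m) ⟨
    v μx +∞ fin a +∞ v m      ≡⟨ ≡.cong (_+∞ v m) (+∞-comm (v μx) (fin a)) ⟩
    fin a +∞ v μx +∞ v m      ≡⟨ +∞-assoc (fin a) (v μx) (v m) ⟩
    fin a +∞ (v μx +∞ v m)    ∎)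
    where
    open ≤∞-Reasoning
    v-minors : fin a +∞ v m ≡ v μ₀ +∞ v m′
    v-minors = ≡.trans (≡.cong (_+∞ v m) (≡.sym vμ₁≡a)) (≡.trans (≡.sym (v-mul μ₁ m)) (≡.trans (v-cong minors) (v-mul μ₀ m′)))

  -- Columns 4, 3 make this minor 1 on τ₁ and ϖ⁻² on τ₂.
  minor : Mat 6 → Carrier
  minor g = det₂ (GL₂-rows f4 f3 g)

  cancel-right-factor : ∀ {h₀ h₁ x y k₀ k₁ L g E₀ E₁ : Mat 6} → h₀ ≈ₘ E₀ → h₁ ≈ₘ E₁ → k₁ · L ≈ₘ 1ₘ →
                        g ≈ₘ h₀ · x · k₀ → g ≈ₘ h₁ · y · k₁ → E₁ · y ≈ₘ E₀ · (x · (k₀ · L))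
  cancel-right-factor {h₀} {h₁} {x} {y} {k₀} {k₁} {L} {g} {E₀} {E₁} h₀≈E₀ h₁≈E₁ k₁·L≈1 g≈₀ g≈₁ = begin
    E₁ · y                ≈⟨ ·-congʳ y h₁≈E₁ ⟨
    h₁ · y                ≈⟨ ·-identityʳ (h₁ · y) ⟨
    h₁ · y · 1ₘ           ≈⟨ ·-congˡ (h₁ · y) k₁·L≈1 ⟨
    h₁ · y · (k₁ · L)     ≈⟨ ·-assoc (h₁ · y) k₁ L ⟨
    h₁ · y · k₁ · L       ≈⟨ ·-congʳ L g≈₁ ⟨
    g · L                 ≈⟨ ·-congʳ L g≈₀ ⟩
    h₀ · x · k₀ · L       ≈⟨ ·-assoc (h₀ · x) k₀ L ⟩
    h₀ · x · (k₀ · L)     ≈⟨ ·-assoc h₀ x (k₀ · L) ⟩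
    h₀ · (x · (k₀ · L))   ≈⟨ ·-congʳ (x · (k₀ · L)) h₀≈E₀ ⟩
    E₀ · (x · (k₀ · L))   ∎
    where open ≈ₘ-Reasoning

  coset-bound : ∀ x y {μx μy g} → IsSim 3 x μx → IsSim 3 y μy → IntegralMat x →
                InDoubleCoset x g → InDoubleCoset y g → v μy ≤∞ v μx +∞ v (minor y)
  coset-bound x y {μx} {μy} {g} sim-x sim-y x-int
    (h₀ , k₀ , (A₀ , M₀ , μ₀ , _    , detA₀ , sim-M₀ , h₀≈) , (k₀-int , ν₀ , ν₀-unit , sim-k₀) , g≈₀)
    (h₁ , k₁ , (A₁ , M₁ , μ₁ , μ₁≉0 , detA₁ , sim-M₁ , h₁≈) , k₁∈K@(_ , ν₁ , ν₁-unit , sim-k₁) , g≈₁)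
    = valuation-bound μ₁≉0 ν₀-unit ν₁-unit (Integral-det₂ (IntegralMat-GL₂-rows f4 f3 W-int)) multipliers minors
    where
    L : Mat 6
    L = proj₁ (K-right-inverse k₁∈K)
    L-int : IntegralMat L
    L-int = proj₁ (proj₂ (K-right-inverse k₁∈K))
    k₁·L≈1 : k₁ · L ≈ₘ 1ₘ
    k₁·L≈1 = proj₂ (proj₂ (K-right-inverse k₁∈K))
    W : Mat 6
    W = x · (k₀ · L)
    W-int : IntegralMat W
    W-int = IntegralMat-· x-int (IntegralMat-· k₀-int L-int)
    multipliers : μ₀ * μx * ν₀ ≈ μ₁ * μy * ν₁
    multipliers = IsSim-unique {g}
      (IsSim-double-coset {A₀} {M₀} {μ₀} {x} {μx} {k₀} {ν₀} {g} {h₀} h₀≈ detA₀ sim-M₀ sim-x sim-k₀ g≈₀)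
      (IsSim-double-coset {A₁} {M₁} {μ₁} {y} {μy} {k₁} {ν₁} {g} {h₁} h₁≈ detA₁ sim-M₁ sim-y sim-k₁ g≈₁)
    blocks : embed A₁ M₁ · y ≈ₘ embed A₀ M₀ · W
    blocks = cancel-right-factor {h₀} {h₁} {x} {y} {k₀} {k₁} {L} {g} h₀≈ h₁≈ k₁·L≈1 g≈₀ g≈₁
    minors : μ₁ * minor y ≈ μ₀ * minor W
    minors = begin
      μ₁ * minor y                 ≈⟨ *-congʳ detA₁ ⟨
      det₂ A₁ * minor y            ≈⟨ det₂-GL₂-rows-embed-· f4 f3 A₁ M₁ y ⟨
      minor (embed A₁ M₁ · y)      ≈⟨ det₂-cong (GL₂-rows-cong f4 f3 blocks) ⟩
      minor (embed A₀ M₀ · W)      ≈⟨ det₂-GL₂-rows-embed-· f4 f3 A₀ M₀ W ⟩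
      det₂ A₀ * minor W            ≈⟨ *-congʳ detA₀ ⟩
      μ₀ * minor W                 ∎
      where open ≈-Reasoning

  separated : ∀ x y {μx μy a b e} → IsSim 3 x μx → IsSim 3 y μy → IntegralMat x →
              v μx ≡ fin a → v μy ≡ fin b → v (minor y) ≡ fin e → ¬ (b ℤ.≤ a ℤ.+ e) →
              Disjoint (InDoubleCoset x) (InDoubleCoset y)
  separated x y {μx} {μy} sim-x sim-y x-int vμx≡a vμy≡b vminor≡e b≰a+e g g∈HxK g∈HyK =
    b≰a+e (fin≤fin⁻¹ (≡.subst₂ _≤∞_ vμy≡b (≡.cong₂ _+∞_ vμx≡a vminor≡e) bound))
    where
    bound : v μy ≤∞ v μx +∞ v (minor y)
    bound = coset-bound x y {μx} {μy} {g} sim-x sim-y x-int g∈HxK g∈HyK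

  τ₁ₚ : ∀ {k} → PolyMat 6 (suc k)
  τ₁ₚ f0 f0 = var zero
  τ₁ₚ f1 f1 = var zero
  τ₁ₚ f2 f2 = var zero
  τ₁ₚ f3 f3 = con (+ 1)
  τ₁ₚ f4 f4 = con (+ 1)
  τ₁ₚ f5 f5 = con (+ 1)
  τ₁ₚ f0 f4 = con (+ 1)
  τ₁ₚ f1 f3 = con (+ 1)
  τ₁ₚ _  _  = con (+ 0)

  IsSim-τ₁ : IsSim 3 τ₁ ϖ
  IsSim-τ₁ = by-computation (τ₁ₚ ᵀₚ ·ₚ Jₚ 3 ·ₚ τ₁ₚ) (var zero •ₚ Jₚ 3) (ϖ ∷ []) ≡.refl ≡.refl _

  τ₂ₚ : PolyMat 6 2
  τ₂ₚ f0 f0 = var zero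
  τ₂ₚ f1 f1 = var zero
  τ₂ₚ f2 f2 = con (+ 1)
  τ₂ₚ f3 f3 = var (suc zero)
  τ₂ₚ f4 f4 = var (suc zero)
  τ₂ₚ f5 f5 = con (+ 1)
  τ₂ₚ f0 f4 = var (suc zero)
  τ₂ₚ f1 f3 = var (suc zero)
  τ₂ₚ _  _  = con (+ 0)

  Jₜₚ : ∀ {k} → Polynomial k → PolyMat 6 k
  Jₜₚ t = Jₚ 3 ·ₚ diagₚ
    where
    diagₚ : PolyMat 6 _
    diagₚ f0 f0 = t
    diagₚ f1 f1 = t
    diagₚ f2 f2 = con (+ 1)
    diagₚ f3 f3 = t
    diagₚ f4 f4 = t
    diagₚ f5 f5 = con (+ 1)
    diagₚ _  _  = con (+ 0)

  -- Normalisation cannot use ϖ ϖ⁻¹ = 1, so the form preserved by τ₂ is first computed in terms of ϖ ϖ⁻¹.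
  IsSim-τ₂ : IsSim 3 τ₂ 1#
  IsSim-τ₂ = begin
    τ₂ ᵀ · J 3 · τ₂
      ≈⟨ by-computation (τ₂ₚ ᵀₚ ·ₚ Jₚ 3 ·ₚ τ₂ₚ) (Jₜₚ (var zero :* var (suc zero))) (ϖ ∷ ϖ ⁻¹ ∷ []) ≡.refl ≡.refl _ ⟩
    ⟦ Jₜₚ (var zero) ⟧ₘ (ϖ * ϖ ⁻¹ ∷ [])
      ≈⟨ (λ i j → ⟦⟧-cong (Jₜₚ (var zero) i j) λ { zero → ⁻¹-inverse ϖ ϖ≉0 ; (suc ()) }) ⟩
    ⟦ Jₜₚ (var zero) ⟧ₘ (1# ∷ [])
      ≈⟨ by-computation (Jₜₚ (con (+ 1))) (con (+ 1) •ₚ Jₚ 3) [] ≡.refl ≡.refl _ ⟩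
    1# • J 3
      ∎
    where open ≈ₘ-Reasoning

  IntegralMat-τ₁ : IntegralMat τ₁
  IntegralMat-τ₁ = IntegralMat-by-computation τ₁ₚ {ϖ ∷ []} ≡.refl λ { zero → Integral-ϖ ; (suc ()) }

  v-diagonal-minor : ∀ {x n} → v x ≡ fin n → v (x * x - 0# * 0#) ≡ fin (n ℤ.+ n)
  v-diagonal-minor {x} vx≡n = ≡.trans (v-cong x²-0²≈x²) (v-*-fin vx≡n vx≡n)
    where
    x²-0²≈x² : x * x - 0# * 0# ≈ x * x
    x²-0²≈x² = prove (x ∷ []) (var zero :* var zero :- con (+ 0) :* con (+ 0)) (var zero :* var zero) refl

  v-minor-τ₁ : v (minor τ₁) ≡ fin (+ 0)
  v-minor-τ₁ = v-diagonal-minor v-1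

  v-minor-τ₂ : v (minor τ₂) ≡ fin -[1+ 1 ]
  v-minor-τ₂ = v-diagonal-minor v-ϖ⁻¹

lemma7p2p2 : ∀ {c ℓ} (F : LocalField c ℓ) → let open Matrices F in
    Disjoint (InDoubleCoset 1ₘ) (InDoubleCoset τ₁) ×
    Disjoint (InDoubleCoset 1ₘ) (InDoubleCoset τ₂) ×
    Disjoint (InDoubleCoset τ₁) (InDoubleCoset τ₂)
lemma7p2p2 F =
    separated 1ₘ τ₁ IsSim-1 IsSim-τ₁ IntegralMat-1 v-1 v-ϖ v-minor-τ₁ (λ { (ℤ.+≤+ ()) })
  , separated 1ₘ τ₂ IsSim-1 IsSim-τ₂ IntegralMat-1 v-1 v-1 v-minor-τ₂ (λ ())
  , separated τ₁ τ₂ IsSim-τ₁ IsSim-τ₂ IntegralMat-τ₁ v-ϖ v-1 v-minor-τ₂ (λ ())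
  where
  open Matrices F
  open LocalField F using (v-ϖ)
  open OverLocalField F
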